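{- Let $k\ge5$, let $\mathcal{C}$ be a $k$-dense family of cycles, and let $G'$ be a $\mathcal{C}$-free graph with a specified vertex $h$. If $B$ is a nearly $h$-dominated block of $G'$ and $u\in B$ is the vertex of $B$ not adjacent to $h$, then $G'+uh$ is $\mathcal{C}$-free.
   Context: $C_\ell$ is the cycle of length $\ell$; $\mathcal{C}$-free means containing no subgraph isomorphic to a member of $\mathcal{C}$; $G'+uh$ is $G'$ with the edge $uh$ added. For $k\geq5$, a family of cycles $\mathcal{C}$ is $k$-dense if: (1) $C_k,C_{k+1}\in\mathcal{C}$, except that when $k=5$ only $C_5\in\mathcal{C}$ is required; (2) $C_\ell\notin\mathcal{C}$ for all $\ell<k$; (3) for every $s\ge3$ there is $\ell$ with $s+2\le\ell\le3+(k-2)(s-2)$ and $C_\ell\in\mathcal{C}$. A block is a maximal subgraph that is a $K_2$ or $2$-connected. A block $B$ is nearly $h$-dominated if $h\in B$ and all but exactly one vertex of $B$ are adjacent to $h$. -}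

module Defs where

open import Data.Nat using (ℕ; zero; suc; _+_; _*_; _∸_; _≤_; _<_)
open import Data.Fin using (Fin; toℕ)
open import Data.Product using (Σ; _×_; _,_; ∃)
open import Data.Sum using (_⊎_; inj₁; inj₂)
open import Data.Empty using (⊥)
open import Relation.Nullary using (¬_)
open import Relation.Binary.PropositionalEquality using (_≡_; _≢_; refl; sym; trans)

record Graph (n : ℕ) : Set₁ where
  field
    Adj    : Fin n → Fin n → Set
    adj-sym    : ∀ {x y} → Adj x y → Adj y x
    adj-irrefl : ∀ {x} → ¬ Adj x x
open Graph public using (Adj)

addEdge : ∀ {n} → Graph n → (u h : Fin n) → u ≢ h → Graph n
addEdge {n} G u h u≢h = record { Adj = A ; adj-sym = s ; adj-irrefl = i }
  where
  A : Fin n → Fin n → Set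
  A x y = Adj G x y ⊎ ((x ≡ u × y ≡ h) ⊎ (x ≡ h × y ≡ u))
  s : ∀ {x y} → A x y → A y x
  s (inj₁ e) = inj₁ (Graph.adj-sym G e)
  s (inj₂ (inj₁ (p , q))) = inj₂ (inj₂ (q , p))
  s (inj₂ (inj₂ (p , q))) = inj₂ (inj₁ (q , p))
  i : ∀ {x} → ¬ A x x
  i (inj₁ e) = Graph.adj-irrefl G e
  i (inj₂ (inj₁ (p , q))) = u≢h (trans (sym p) q)
  i (inj₂ (inj₂ (p , q))) = u≢h (trans (sym q) p)

HasCycle : ∀ {n} → Graph n → ℕ → Set
HasCycle {n} G ℓ =
  (3 ≤ ℓ) × Σ (Fin ℓ → Fin n) λ f →
    (∀ i j → f i ≡ f j → i ≡ j) ×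
    (∀ i j → toℕ j ≡ suc (toℕ i) → Adj G (f i) (f j)) ×
    (∀ i j → toℕ i ≡ 0 → suc (toℕ j) ≡ ℓ → Adj G (f j) (f i))

-- A family of cycles is given by the set of its lengths.
CycleFamily : Set₁
CycleFamily = ℕ → Set

Free : ∀ {n} → CycleFamily → Graph n → Set
Free 𝒞 G = ∀ ℓ → 𝒞 ℓ → ¬ HasCycle G ℓ

Dense : ℕ → CycleFamily → Set
Dense k 𝒞 =
  (𝒞 k × (k ≢ 5 → 𝒞 (suc k))) ×
  (∀ ℓ → ℓ < k → ¬ 𝒞 ℓ) ×
  (∀ s → 3 ≤ s → Σ ℕ λ ℓ → (s + 2 ≤ ℓ) × (ℓ ≤ 3 + (k ∸ 2) * (s ∸ 2)) × 𝒞 ℓ)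

VSet : ℕ → Set₁
VSet n = Fin n → Set

_⊆_ : ∀ {n} → VSet n → VSet n → Set
S ⊆ T = ∀ x → S x → T x

data Reach {n} (G : Graph n) (S : VSet n) : Fin n → Fin n → Set where
  here : ∀ {x} → S x → Reach G S x x
  step : ∀ {x y z} → S x → Adj G x y → Reach G S y z → Reach G S x z

Connected : ∀ {n} → Graph n → VSet n → Set
Connected G S = ∀ x y → S x → S y → Reach G S x y

_─_ : ∀ {n} → VSet n → Fin n → VSet n
(S ─ v) x = S x × x ≢ v

TwoConnected : ∀ {n} → Graph n → VSet n → Set
TwoConnected G S =
  (Σ _ λ a → Σ _ λ b → Σ _ λ c → S a × S b × S c × a ≢ b × b ≢ c × a ≢ c) ×
  Connected G S ×
  (∀ v → S v → Connected G (S ─ v))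

IsK2 : ∀ {n} → Graph n → VSet n → Set
IsK2 G S = Σ _ λ a → Σ _ λ b →
  S a × S b × a ≢ b × Adj G a b × (∀ z → S z → z ≡ a ⊎ z ≡ b)

-- A block: a maximal (vertex set of a) subgraph that is K₂ or 2-connected.
-- (Such maximal subgraphs are induced, so vertex sets suffice.)
IsBlock : ∀ {n} → Graph n → VSet n → Set₁
IsBlock G B =
  (IsK2 G B ⊎ TwoConnected G B) ×
  (∀ B' → B ⊆ B' → (IsK2 G B' ⊎ TwoConnected G B') → B' ⊆ B)

NearlyDominated : ∀ {n} → Graph n → VSet n → Fin n → Set
NearlyDominated G B h =
  B h × Σ _ λ u → B u × u ≢ h × ¬ Adj G u h ×
    (∀ v → B v → v ≢ h → v ≢ u → Adj G v h)

-- Deleting uh from a cycle of G + uh whose length ℓ lies in 𝒞 leaves a u–h path P in G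
-- with ℓ − 1 edges.  B together with P is still 2-connected, so maximality of the block
-- forces P ⊆ B; hence every inner vertex of P is adjacent to h, and h closes any
-- stretch of inner vertices of P into a cycle.  As ℓ ≥ k, this gives a k-cycle if ℓ > k.
-- When ℓ = k, 2-connectivity of B − P₁ gives a neighbour w ≠ P₁ of u in B, which is
-- adjacent to h: the cycle h w u P₁ … P_{k−3} (w off P), or u P₁ … P_{j−1} h P_{k−2} … P_j
-- (w = P_j), has length k.  Either way G contains C_k ∈ 𝒞.

module Submission where

open import Defs
open import Data.Nat using (ℕ; zero; suc; _+_; _∸_; _≤_; _<_; z≤n; s≤s; s≤s⁻¹)
open import Data.Nat.Properties hiding (_≟_)
open import Data.Nat.DivMod using (m%n<n; m<n⇒m%n≡m)
open import Data.Fin using (Fin; toℕ; fromℕ<)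
open import Data.Fin.Properties using (toℕ-injective; toℕ-fromℕ<; toℕ<n; _≟_)
open import Data.Product using (Σ-syntax; ∃; _×_; _,_; proj₁; proj₂)
open import Data.Sum using (_⊎_; inj₁; inj₂)
import Data.Sum as Sum
open import Data.Empty using (⊥; ⊥-elim)
open import Function using (_∘_)
open import Relation.Nullary using (¬_; Dec; yes; no)
open import Relation.Nullary.Decidable using (_×-dec_; _⊎-dec_; ¬¬-excluded-middle)
open import Relation.Unary using (Decidable; _∪_)
open import Relation.Binary.PropositionalEquality

private
  variable
    n m m₁ m₂ L : ℕ

-- juxt m p q t lists p 0, …, p m, q 0, q 1, … as t runs through ℕ.
juxt : ∀ {A : Set} → ℕ → (ℕ → A) → (ℕ → A) → ℕ → A
juxt m       p q zero    = p zero
juxt zero    p q (suc t) = q t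
juxt (suc m) p q (suc t) = juxt m (p ∘ suc) q t

juxt-left : ∀ {A : Set} {p q : ℕ → A} {t} → t ≤ m → juxt m p q t ≡ p t
juxt-left z≤n = refl
juxt-left {m = suc m} (s≤s t≤m) = juxt-left {m = m} t≤m

juxt-next : ∀ {A : Set} {p q : ℕ → A} m → juxt m p q (suc m) ≡ q 0
juxt-next zero    = refl
juxt-next (suc m) = juxt-next m

juxt-right : ∀ {A : Set} {p q : ℕ → A} m s → juxt m p q (suc (m + s)) ≡ q s
juxt-right zero    s = refl
juxt-right (suc m) s = juxt-right m s

split-at : ∀ m t → t ≤ m ⊎ ∃ λ s → t ≡ suc (m + s)
split-at m       zero    = inj₁ z≤n
split-at zero    (suc t) = inj₂ (t , refl)
split-at (suc m) (suc t) = Sum.map s≤s (λ (s , e) → s , cong suc e) (split-at m t)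

m<n⇒n≡1+[n∸1+m]+m : m < n → n ≡ suc ((n ∸ suc m) + m)
m<n⇒n≡1+[n∸1+m]+m {m} {n} m<n = sym (trans (sym (+-suc (n ∸ suc m) m)) (m∸n+n≡m m<n))

module _ {G : Graph n} where

  reach-source : ∀ {S x y} → Reach G S x y → S x
  reach-source (here s) = s
  reach-source (step s _ _) = s

  reach-++ : ∀ {S x y z} → Reach G S x y → Reach G S y z → Reach G S x z
  reach-++ (here _) r = r
  reach-++ (step s a r) r′ = step s a (reach-++ r r′)

  reach-mono : ∀ {S T x y} → S ⊆ T → Reach G S x y → Reach G T x y
  reach-mono S⊆T (here s) = here (S⊆T _ s)
  reach-mono S⊆T (step s a r) = step (S⊆T _ s) a (reach-mono S⊆T r)

  reach-sym : ∀ {S x y} → Reach G S x y → Reach G S y x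
  reach-sym (here s) = here s
  reach-sym (step s a r) = reach-++ (reach-sym r) (step (reach-source r) (Graph.adj-sym G a) (here s))

  reach-first-step : ∀ {S x y} → Reach G S x y → x ≢ y → ∃ λ w → Adj G x w × S w
  reach-first-step (here _) x≢x = ⊥-elim (x≢x refl)
  reach-first-step (step _ a r) _ = _ , a , reach-source r

  reach-hub⇒connected : ∀ {S c} → (∀ x → S x → Reach G S x c) → Connected G S
  reach-hub⇒connected to-c x y x∈S y∈S = reach-++ (to-c x x∈S) (reach-sym (to-c y y∈S))

-- A path with m edges through the distinct vertices vertex 0, …, vertex m;
-- the values of vertex beyond m are junk.
record Path (G : Graph n) (m : ℕ) : Set where
  field
    vertex    : ℕ → Fin n
    adjacent  : ∀ i → i < m → Adj G (vertex i) (vertex (suc i))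
    injective : ∀ i j → i ≤ m → j ≤ m → vertex i ≡ vertex j → i ≡ j
open Path

module _ {G : Graph n} where

  first : Path G m → Fin n
  first P = vertex P 0

  last : Path G m → Fin n
  last {m = m} P = vertex P m

  OnPath : Path G m → VSet n
  OnPath {m = m} P x = ∃ λ i → i ≤ m × vertex P i ≡ x

  Disjoint : Path G m₁ → Path G m₂ → Set
  Disjoint P Q = ∀ {x} → OnPath P x → OnPath Q x → ⊥

  single : Fin n → Path G 0
  single x = record
    { vertex    = λ _ → x
    ; adjacent  = λ _ ()
    ; injective = λ { _ _ z≤n z≤n _ → refl }
    }

  take : (P : Path G m) → m₁ ≤ m → Path G m₁
  take P m₁≤m = record
    { vertex    = vertex P
    ; adjacent  = λ i i<m₁ → adjacent P i (<-≤-trans i<m₁ m₁≤m)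
    ; injective = λ i j i≤ j≤ → injective P i j (≤-trans i≤ m₁≤m) (≤-trans j≤ m₁≤m)
    }

  slice : (P : Path G m) (a : ℕ) → m₁ + a ≤ m → Path G m₁
  slice P a bound = record
    { vertex    = λ t → vertex P (t + a)
    ; adjacent  = λ t t<m₁ → adjacent P (t + a) (<-≤-trans (+-monoˡ-< a t<m₁) bound)
    ; injective = λ i j i≤ j≤ e → +-cancelʳ-≡ a i j
        (injective P (i + a) (j + a) (≤-trans (+-monoˡ-≤ a i≤) bound)
          (≤-trans (+-monoˡ-≤ a j≤) bound) e)
    }

  reverse : Path G m → Path G m
  reverse {m = m} P = record
    { vertex    = λ t → vertex P (m ∸ t)
    ; adjacent  = adj
    ; injective = λ i j i≤ j≤ e →
        ∸-cancelˡ-≡ i≤ j≤ (injective P _ _ (m∸n≤m m i) (m∸n≤m m j) e)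
    }
    where
    adj : ∀ t → t < m → Adj G (vertex P (m ∸ t)) (vertex P (m ∸ suc t))
    adj t (s≤s {n = m′} t≤m′) =
      subst (λ i → Adj G (vertex P i) (vertex P (m′ ∸ t))) (sym (+-∸-assoc 1 t≤m′))
        (Graph.adj-sym G (adjacent P (m′ ∸ t) (s≤s (m∸n≤m m′ t))))

  last-reverse : (P : Path G m) → last (reverse P) ≡ first P
  last-reverse {m = m} P = cong (vertex P) (n∸n≡0 m)

  join : (P : Path G m₁) (Q : Path G m₂) → Adj G (last P) (first Q) → Disjoint P Q →
         Path G (suc (m₁ + m₂))
  join {m₁ = m₁} {m₂ = m₂} P Q bridge disjoint = record
    { vertex = v ; adjacent = adj ; injective = inj }
    where
    v = juxt m₁ (vertex P) (vertex Q)

    left : ∀ {t} → t ≤ m₁ → v t ≡ vertex P t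
    left = juxt-left

    right : ∀ s → v (suc (m₁ + s)) ≡ vertex Q s
    right = juxt-right {p = vertex P} m₁

    right-bound : ∀ {s} → suc (m₁ + s) ≤ suc (m₁ + m₂) → s ≤ m₂
    right-bound (s≤s le) = +-cancelˡ-≤ m₁ _ _ le

    adj : ∀ t → t < suc (m₁ + m₂) → Adj G (v t) (v (suc t))
    adj t t< with split-at m₁ t
    ... | inj₂ (s , refl) =
      subst₂ (Adj G) (sym (right s))
        (sym (trans (cong (v ∘ suc) (sym (+-suc m₁ s))) (right (suc s))))
        (adjacent Q s (right-bound (subst (_≤ suc (m₁ + m₂)) (cong suc (sym (+-suc m₁ s))) t<)))
    ... | inj₁ t≤m₁ with m≤n⇒m<n∨m≡n t≤m₁
    ...   | inj₁ t<m₁ = subst₂ (Adj G) (sym (left t≤m₁)) (sym (left t<m₁)) (adjacent P t t<m₁)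
    ...   | inj₂ refl = subst₂ (Adj G) (sym (left t≤m₁)) (sym (juxt-next {p = vertex P} m₁)) bridge

    apart : ∀ i s → i ≤ m₁ → s ≤ m₂ → v i ≢ v (suc (m₁ + s))
    apart i s i≤ s≤ e =
      disjoint (i , i≤ , refl) (s , s≤ , trans (sym (right s)) (trans (sym e) (left i≤)))

    inj : ∀ i j → i ≤ suc (m₁ + m₂) → j ≤ suc (m₁ + m₂) → v i ≡ v j → i ≡ j
    inj i j i≤ j≤ e with split-at m₁ i | split-at m₁ j
    ... | inj₁ i≤m₁ | inj₁ j≤m₁ =
      injective P i j i≤m₁ j≤m₁ (trans (sym (left i≤m₁)) (trans e (left j≤m₁)))
    ... | inj₁ i≤m₁ | inj₂ (s , refl) = ⊥-elim (apart i s i≤m₁ (right-bound j≤) e)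
    ... | inj₂ (s , refl) | inj₁ j≤m₁ = ⊥-elim (apart j s j≤m₁ (right-bound i≤) (sym e))
    ... | inj₂ (s , refl) | inj₂ (s′ , refl) =
      cong (suc ∘ (m₁ +_)) (injective Q s s′ (right-bound i≤) (right-bound j≤)
        (trans (sym (right s)) (trans e (right s′))))

  onPath-join : ∀ {x} (P : Path G m₁) (Q : Path G m₂)
                (b : Adj G (last P) (first Q)) (d : Disjoint P Q) →
                OnPath (join P Q b d) x → OnPath P x ⊎ OnPath Q x
  onPath-join {m₁ = m₁} P Q b d (t , t≤ , refl) with split-at m₁ t
  ... | inj₁ t≤m₁ = inj₁ (t , t≤m₁ , sym (juxt-left t≤m₁))
  ... | inj₂ (s , refl) = inj₂ (s , +-cancelˡ-≤ m₁ _ _ (s≤s⁻¹ t≤) , sym (juxt-right m₁ s))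

  last-join : (P : Path G m₁) (Q : Path G m₂) (b : Adj G (last P) (first Q)) (d : Disjoint P Q) →
              last (join P Q b d) ≡ last Q
  last-join {m₁ = m₁} {m₂ = m₂} P Q b d = juxt-right m₁ m₂

  closedPath⇒cycle : (C : Path G m) → 2 ≤ m → Adj G (last C) (first C) → HasCycle G (suc m)
  closedPath⇒cycle {m = m} C 2≤m closing =
    s≤s 2≤m , vertex C ∘ toℕ , inj , adj , close
    where
    inj : ∀ i j → vertex C (toℕ i) ≡ vertex C (toℕ j) → i ≡ j
    inj i j e = toℕ-injective (injective C _ _ (s≤s⁻¹ (toℕ<n i)) (s≤s⁻¹ (toℕ<n j)) e)
    adj : ∀ i j → toℕ j ≡ suc (toℕ i) → Adj G (vertex C (toℕ i)) (vertex C (toℕ j))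
    adj i j e = subst (Adj G _ ∘ vertex C) (sym e)
                  (adjacent C (toℕ i) (s≤s⁻¹ (subst (_< suc m) e (toℕ<n j))))
    close : ∀ i j → toℕ i ≡ 0 → suc (toℕ j) ≡ suc m →
            Adj G (vertex C (toℕ j)) (vertex C (toℕ i))
    close i j i≡0 j≡m =
      subst₂ (λ a b → Adj G (vertex C a) (vertex C b)) (sym (suc-injective j≡m)) (sym i≡0) closing

  cycle⇒closedPath : HasCycle G (suc m) → 2 ≤ m × Σ[ C ∈ Path G m ] Adj G (last C) (first C)
  cycle⇒closedPath {m = m} (s≤s 2≤m , f , f-inj , f-adj , f-close) =
    2≤m , C , f-close (index 0) (index m) (toℕ-index z≤n) (cong suc (toℕ-index ≤-refl))
    where
    index : ℕ → Fin (suc m)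
    index i = fromℕ< (m%n<n i (suc m))
    toℕ-index : ∀ {i} → i ≤ m → toℕ (index i) ≡ i
    toℕ-index i≤m = trans (toℕ-fromℕ< _) (m<n⇒m%n≡m (s≤s i≤m))
    C : Path G m
    C = record
      { vertex    = f ∘ index
      ; adjacent  = λ i i<m → f-adj (index i) (index (suc i))
                      (trans (toℕ-index i<m) (cong suc (sym (toℕ-index (<⇒≤ i<m)))))
      ; injective = λ i j i≤ j≤ e →
          trans (sym (toℕ-index i≤)) (trans (cong toℕ (f-inj _ _ e)) (toℕ-index j≤))
      }

  rotate : (C : Path G m) → Adj G (last C) (first C) → ∀ {p} → p < m →
           Σ[ R ∈ Path G m ] first R ≡ vertex C (suc p) × last R ≡ vertex C p
  rotate {m = m} C closing {p} p<m with m ∸ suc p | m<n⇒n≡1+[n∸1+m]+m p<m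
  ... | o | refl = join tail prefix bridge disjoint , refl , last-join tail prefix bridge disjoint
    where
    tail = slice C (suc p) (≤-reflexive (+-suc o p))
    prefix = take C (m≤n⇒m≤1+n (m≤n+m p o))
    bridge : Adj G (vertex C (o + suc p)) (vertex C 0)
    bridge = subst (λ i → Adj G (vertex C i) (vertex C 0)) (sym (+-suc o p)) closing
    disjoint : Disjoint tail prefix
    disjoint (t , t≤o , refl) (i , i≤p , e) =
      <⇒≢ (≤-trans (s≤s i≤p) (m≤n+m (suc p) t))
        (injective C i (t + suc p) (m≤n⇒m≤1+n (≤-trans i≤p (m≤n+m p o)))
          (≤-trans (+-monoˡ-≤ (suc p) t≤o) (≤-reflexive (+-suc o p))) e)

PathBetween : Graph n → Fin n → Fin n → ℕ → Set
PathBetween G a b m = Σ[ P ∈ Path G m ] first P ≡ a × last P ≡ b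

IsEdge : Fin n → Fin n → Fin n → Fin n → Set
IsEdge u h x y = (x ≡ u × y ≡ h) ⊎ (x ≡ h × y ≡ u)

module _ {u h : Fin n} where

  isEdge? : ∀ x y → Dec (IsEdge u h x y)
  isEdge? x y = ((x ≟ u) ×-dec (y ≟ h)) ⊎-dec ((x ≟ h) ×-dec (y ≟ u))

  isEdge-match : ∀ {a b c d} → IsEdge u h a b → IsEdge u h c d →
                 (a ≡ c × b ≡ d) ⊎ (a ≡ d × b ≡ c)
  isEdge-match (inj₁ (refl , refl)) (inj₁ (refl , refl)) = inj₁ (refl , refl)
  isEdge-match (inj₁ (refl , refl)) (inj₂ (refl , refl)) = inj₂ (refl , refl)
  isEdge-match (inj₂ (refl , refl)) (inj₁ (refl , refl)) = inj₂ (refl , refl)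
  isEdge-match (inj₂ (refl , refl)) (inj₂ (refl , refl)) = inj₁ (refl , refl)

  closing-edge-unique : ∀ {G : Graph n} (C : Path G m) → 2 ≤ m → IsEdge u h (last C) (first C) →
                        ∀ i → i < m → ¬ IsEdge u h (vertex C i) (vertex C (suc i))
  closing-edge-unique {m = m} C 2≤m closing i i<m e with isEdge-match e closing
  ... | inj₁ (i~m , _) = <⇒≢ i<m (injective C i m (<⇒≤ i<m) ≤-refl i~m)
  ... | inj₂ (i~0 , i+1~m) with injective C i 0 (<⇒≤ i<m) z≤n i~0
  ...   | refl = <⇒≢ 2≤m (injective C 1 m (<⇒≤ 2≤m) ≤-refl i+1~m)

  orient : ∀ {G : Graph n} (P : Path G m) → IsEdge u h (last P) (first P) → PathBetween G u h m
  orient P (inj₁ (last≡u , first≡h)) = reverse P , last≡u , trans (last-reverse P) first≡h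
  orient P (inj₂ (last≡h , first≡u)) = P , first≡u , last≡h

  module _ {G : Graph n} {u≢h : u ≢ h} where

    delete-edge : (P : Path (addEdge G u h u≢h) m) →
                 (∀ i → i < m → ¬ IsEdge u h (vertex P i) (vertex P (suc i))) → Path G m
    delete-edge P avoids = record
      { vertex    = vertex P
      ; adjacent  = λ i i<m →
          Sum.[ (λ a → a) , (λ e → ⊥-elim (avoids i i<m e)) ] (adjacent P i i<m)
      ; injective = injective P
      }

    open-at-closing-edge : (C : Path (addEdge G u h u≢h) m) → 2 ≤ m →
                           IsEdge u h (last C) (first C) → PathBetween G u h m
    open-at-closing-edge C 2≤m e = orient (delete-edge C (closing-edge-unique C 2≤m e)) e

    added-edge-cycle⇒path : ¬ HasCycle G (suc m) → HasCycle (addEdge G u h u≢h) (suc m) →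
                            PathBetween G u h m
    added-edge-cycle⇒path {m = m} no-cycle cycle with cycle⇒closedPath cycle
    ... | 2≤m , C , closing with anyUpTo? (λ i → isEdge? (vertex C i) (vertex C (suc i))) m
    ...   | yes (p , p<m , e) =
      let R , first≡ , last≡ = rotate C closing p<m
      in open-at-closing-edge R 2≤m (subst₂ (IsEdge u h) (sym last≡) (sym first≡) e)
    ...   | no none with closing
    ...     | inj₁ old =
      ⊥-elim (no-cycle (closedPath⇒cycle (delete-edge C λ i i<m e → none (i , i<m , e)) 2≤m old))
    ...     | inj₂ e = open-at-closing-edge C 2≤m e

module _ {G : Graph n} where

  close-through : ∀ {h} (Q : Path G m) → 1 ≤ m → Adj G h (first Q) → Adj G (last Q) h →
                  ¬ OnPath Q h → HasCycle G (suc (suc m))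
  close-through {h = h} Q 1≤m h~first last~h h∉Q =
    closedPath⇒cycle (join (single h) Q h~first h-apart) (s≤s 1≤m) last~h
    where
    h-apart : Disjoint (single h) Q
    h-apart (_ , _ , refl) = h∉Q

  IsFan : Path G m → Set
  IsFan {m = m} P = ∀ i → 1 ≤ i → i < m → Adj G (vertex P i) (last P)

  inner≢last : (P : Path G m) → ∀ {i} → i < m → vertex P i ≢ last P
  inner≢last {m = m} P {i} i<m e = <⇒≢ i<m (injective P i m (<⇒≤ i<m) ≤-refl e)

  fan-cycle : (P : Path G L) → IsFan P → ∀ c → 3 ≤ c → c ≤ L → HasCycle G c
  fan-cycle {L = L} P fan (suc (suc c)) (s≤s (s≤s 1≤c)) c+2≤L =
    close-through Q 1≤c (Graph.adj-sym G (fan 1 ≤-refl (≤-trans (s≤s (s≤s z≤n)) c+2≤L)))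
      (fan (c + 1) (m≤n+m 1 c) c+1<L) last∉Q
    where
    c+1<L : c + 1 < L
    c+1<L = subst (_< L) (+-comm 1 c) c+2≤L
    Q = slice P 1 (<⇒≤ c+1<L)
    last∉Q : ¬ OnPath Q (last P)
    last∉Q (t , t≤c , e) = inner≢last P (≤-<-trans (+-monoˡ-≤ 1 t≤c) c+1<L) e

  chord-cycle : ∀ {r} (P : Path G L) → IsFan P → (R : Path G r) → ∀ {j} → 1 ≤ j → (j<L : j < L) →
                Adj G (last R) (first P) → Adj G (last P) (first R) → ¬ OnPath R (last P) →
                Disjoint R (take P (<⇒≤ j<L)) → HasCycle G (suc (suc (r + suc j)))
  chord-cycle {r = r} P fan R {j} 1≤j j<L R~P last~R last∉R disjoint =
    subst (HasCycle G ∘ suc ∘ suc) (sym (+-suc r j))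
      (close-through Q (s≤s z≤n) last~R
        (subst (λ x → Adj G x (last P)) (sym (last-join R prefix R~P disjoint)) (fan j 1≤j j<L))
        last∉Q)
    where
    prefix = take P (<⇒≤ j<L)
    Q = join R prefix R~P disjoint
    last∉Q : ¬ OnPath Q (last P)
    last∉Q onQ with onPath-join R prefix R~P disjoint onQ
    ... | inj₁ onR = last∉R onR
    ... | inj₂ (i , i≤j , e) = inner≢last P (≤-<-trans i≤j j<L) e

  chord-to-inner : (P : Path G L) → IsFan P → ∀ {j} → 2 ≤ j → j < L →
                   Adj G (vertex P j) (first P) → HasCycle G (suc L)
  chord-to-inner {L = L} P fan {suc j} (s≤s 1≤j) j<L chord
    with L ∸ suc (suc j) | m<n⇒n≡1+[n∸1+m]+m j<L
  ... | r | refl = chord-cycle P fan R 1≤j j<L′ R~P last~R last∉R disjoint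
    where
    j<L′ : j < suc (r + suc j)
    j<L′ = m≤n⇒m≤1+n (m≤n+m (suc j) r)
    S : Path G r
    S = slice P (suc j) (n≤1+n _)
    R = reverse S
    R~P : Adj G (last R) (first P)
    R~P = subst (λ x → Adj G x (first P)) (sym (last-reverse S)) chord
    last~R : Adj G (last P) (first R)
    last~R = Graph.adj-sym G (fan (r + suc j) (≤-trans (s≤s z≤n) (m≤n+m (suc j) r)) ≤-refl)
    inner : ∀ {t} → (r ∸ t) + suc j < L
    inner {t} = s≤s (+-monoˡ-≤ (suc j) (m∸n≤m r t))
    last∉R : ¬ OnPath R (last P)
    last∉R (t , _ , e) = inner≢last P (inner {t}) e
    disjoint : Disjoint R (take P (<⇒≤ j<L′))
    disjoint (t , _ , refl) (i , i≤j , e) =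
      <⇒≢ (≤-trans (s≤s i≤j) (m≤n+m (suc j) (r ∸ t)))
        (injective P i _ (<⇒≤ (≤-<-trans i≤j j<L′)) (<⇒≤ (inner {t})) e)

  fan-cycle-suc : (P : Path G L) → IsFan P → 3 ≤ L → ∀ {w} → Adj G (first P) w → Adj G w (last P) →
                  w ≢ vertex P 1 → w ≢ last P → HasCycle G (suc L)
  fan-cycle-suc {L = L@(suc (suc L′))} P fan (s≤s (s≤s 1≤L′)) {w} first~w w~last w≢P1 w≢last
    with anyUpTo? (λ i → vertex P i ≟ w) (suc L)
  ... | no w∉P =
    chord-cycle P fan (single w) 1≤L′ (n≤1+n _) (Graph.adj-sym G first~w) (Graph.adj-sym G w~last)
      (λ (_ , _ , e) → w≢last e) disjoint
    where
    disjoint : Disjoint (single w) (take P (<⇒≤ (n≤1+n _)))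
    disjoint (_ , _ , refl) (i , i≤L′ , e) = w∉P (i , s≤s (m≤n⇒m≤1+n (m≤n⇒m≤1+n i≤L′)) , e)
  ... | yes (zero , _ , refl) = ⊥-elim (Graph.adj-irrefl G first~w)
  ... | yes (suc zero , _ , refl) = ⊥-elim (w≢P1 refl)
  ... | yes (suc (suc j) , j<L+1 , refl) with m≤n⇒m<n∨m≡n (s≤s⁻¹ j<L+1)
  ...   | inj₂ refl = ⊥-elim (w≢last refl)
  ...   | inj₁ j<L = chord-to-inner P fan (s≤s (s≤s z≤n)) j<L (Graph.adj-sym G first~w)

module _ {G : Graph n} {B : VSet n} where

  nonadjacent⇒twoConnected : IsBlock G B → ∀ {x y} → B x → B y → x ≢ y → ¬ Adj G x y →
                             TwoConnected G B
  nonadjacent⇒twoConnected (inj₂ B₂ , _) _ _ _ _ = B₂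
  nonadjacent⇒twoConnected (inj₁ (_ , _ , _ , _ , _ , a~b , only) , _) x∈B y∈B x≢y x≁y
    with only _ x∈B | only _ y∈B
  ... | inj₁ refl | inj₁ refl = ⊥-elim (x≢y refl)
  ... | inj₁ refl | inj₂ refl = ⊥-elim (x≁y a~b)
  ... | inj₂ refl | inj₁ refl = ⊥-elim (x≁y (Graph.adj-sym G a~b))
  ... | inj₂ refl | inj₂ refl = ⊥-elim (x≢y refl)

  vertex-other-than : TwoConnected G B → ∀ v → ∃ λ c → B c × c ≢ v
  vertex-other-than ((a , b , _ , a∈B , b∈B , _ , a≢b , _) , _) v with a ≟ v
  ... | no a≢v = a , a∈B , a≢v
  ... | yes refl = b , b∈B , a≢b ∘ sym

  reach-avoiding : Decidable B → TwoConnected G B → ∀ {v x y} → B x → B y → x ≢ v → y ≢ v →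
                   Reach G (B ─ v) x y
  reach-avoiding B? (_ , conn , conn-without) {v} x∈B y∈B x≢v y≢v with B? v
  ... | yes v∈B = conn-without v v∈B _ _ (x∈B , x≢v) (y∈B , y≢v)
  ... | no v∉B = reach-mono (λ z z∈B → z∈B , λ { refl → v∉B z∈B }) (conn _ _ x∈B y∈B)

reach-along : ∀ {G : Graph n} {S} (P : Path G m) → ∀ {t t′} → t ≤ t′ → t′ ≤ m →
       (∀ r → t ≤ r → r ≤ t′ → S (vertex P r)) → Reach G S (vertex P t) (vertex P t′)
reach-along P {t′ = zero} z≤n _ on = here (on 0 z≤n z≤n)
reach-along P {t′ = suc t′} t≤ t′<m on with m≤n⇒m<n∨m≡n t≤
... | inj₂ refl = here (on _ ≤-refl ≤-refl)
... | inj₁ (s≤s t≤t′) =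
  reach-++ (reach-along P t≤t′ (<⇒≤ t′<m) (λ r t≤r r≤t′ → on r t≤r (m≤n⇒m≤1+n r≤t′)))
    (step (on t′ t≤t′ (n≤1+n t′)) (adjacent P t′ t′<m)
      (here (on (suc t′) (m≤n⇒m≤1+n t≤t′) ≤-refl)))

module _ {G : Graph n} {B : VSet n} (B? : Decidable B) (B₂ : TwoConnected G B) where

  ∪-path-twoConnected : (P : Path G m) → B (first P) → B (last P) → TwoConnected G (B ∪ OnPath P)
  ∪-path-twoConnected {m = m} P first∈B last∈B = triangle , reach-hub⇒connected to-first , without
    where
    B∪P = B ∪ OnPath P
    triangle = let (a , b , c , a∈B , b∈B , c∈B , distinct) = proj₁ B₂
               in a , b , c , inj₁ a∈B , inj₁ b∈B , inj₁ c∈B , distinct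
    on : ∀ {r} → r ≤ m → B∪P (vertex P r)
    on r≤m = inj₂ (_ , r≤m , refl)
    lift : ∀ {v} → (B ─ v) ⊆ (B∪P ─ v)
    lift _ (x∈B , x≢v) = inj₁ x∈B , x≢v

    to-first : ∀ x → B∪P x → Reach G B∪P x (first P)
    to-first x (inj₁ x∈B) = reach-mono (λ _ → inj₁) (proj₁ (proj₂ B₂) x _ x∈B first∈B)
    to-first _ (inj₂ (t , t≤m , refl)) =
      reach-sym (reach-along P z≤n t≤m λ r _ r≤t → on (≤-trans r≤t t≤m))

    within-B : ∀ {v x c} → B x → x ≢ v → B c → c ≢ v → Reach G (B∪P ─ v) x c
    within-B x∈B x≢v c∈B c≢v = reach-mono lift (reach-avoiding B? B₂ x∈B c∈B x≢v c≢v)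

    -- A path vertex other than v reaches B without v along the side of P that v is not on.
    to-hub : ∀ {v c} → B c → c ≢ v → ∀ x → (B∪P ─ v) x → Reach G (B∪P ─ v) x c
    to-hub c∈B c≢v x (inj₁ x∈B , x≢v) = within-B x∈B x≢v c∈B c≢v
    to-hub {v} c∈B c≢v _ (inj₂ (t , t≤m , refl) , Pt≢v)
      with anyUpTo? (λ s → vertex P s ≟ v) (suc t)
    ... | yes (s , s<t+1 , refl) =
      reach-++ (reach-along P t≤m ≤-refl above) (within-B last∈B (proj₂ (above m t≤m ≤-refl)) c∈B c≢v)
      where
      above : ∀ r → t ≤ r → r ≤ m → (B∪P ─ vertex P s) (vertex P r)
      above r t≤r r≤m = on r≤m , λ Pr≡Ps →
        let r≡s = injective P r s r≤m (≤-trans (s≤s⁻¹ s<t+1) t≤m) Pr≡Ps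
        in Pt≢v (cong (vertex P) (≤-antisym (subst (t ≤_) r≡s t≤r) (s≤s⁻¹ s<t+1)))
    ... | no v∉P₀ₜ =
      reach-++ (reach-sym (reach-along P z≤n t≤m below)) (within-B first∈B (proj₂ (below 0 z≤n z≤n)) c∈B c≢v)
      where
      below : ∀ r → 0 ≤ r → r ≤ t → (B∪P ─ v) (vertex P r)
      below r _ r≤t = on (≤-trans r≤t t≤m) , λ Pr≡v → v∉P₀ₜ (r , s≤s r≤t , Pr≡v)

    without : ∀ v → B∪P v → Connected G (B∪P ─ v)
    without v _ = let c , c∈B , c≢v = vertex-other-than B₂ v
                  in reach-hub⇒connected (to-hub c∈B c≢v)

  block-contains-path : IsBlock G B → (P : Path G m) → B (first P) → B (last P) →
                        ∀ i → i ≤ m → B (vertex P i)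
  block-contains-path (_ , maximal) P first∈B last∈B i i≤m =
    maximal (B ∪ OnPath P) (λ _ → inj₁) (inj₂ (∪-path-twoConnected P first∈B last∈B))
      _ (inj₂ (i , i≤m , refl))

-- Membership in a vertex set is decidable only classically; this suffices, since the
-- theorem's goal is ⊥.
finite-¬¬-decidable : (P : VSet n) → ¬ ¬ Decidable P
finite-¬¬-decidable {zero} P k = k λ ()
finite-¬¬-decidable {suc n} P k =
  ¬¬-excluded-middle λ P0? → finite-¬¬-decidable (P ∘ Fin.suc) λ P? →
    k λ { Fin.zero → P0? ; (Fin.suc x) → P? x }

nearlyDominated⇒dominated : ∀ {G : Graph n} {B h} → NearlyDominated G B h →
                            ∀ {u} → B u → u ≢ h → ¬ Adj G u h →
                            ∀ v → B v → v ≢ h → v ≢ u → Adj G v h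
nearlyDominated⇒dominated (_ , u′ , _ , _ , _ , dominated) {u} u∈B u≢h u≁h v v∈B v≢h v≢u
  with u ≟ u′
... | yes refl = dominated v v∈B v≢h v≢u
... | no u≢u′ = ⊥-elim (u≁h (dominated u u∈B u≢h u≢u′))

module _ {G : Graph n} {B : VSet n} (block : IsBlock G B) (B? : Decidable B) where

  block-path-cycles : (P : Path G L) → ∀ {u h} → first P ≡ u → last P ≡ h →
                      B u → B h → ¬ Adj G u h → (∀ v → B v → v ≢ h → v ≢ u → Adj G v h) →
                      3 ≤ L → ∀ c → 3 ≤ c → c ≤ suc L → HasCycle G c
  block-path-cycles {L = L} P refl refl first∈B last∈B first≁last dominated 3≤L c 3≤c c≤L+1 =
    Sum.[ (λ c<L+1 → fan-cycle P fan c 3≤c (s≤s⁻¹ c<L+1)) ,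
          (λ c≡L+1 → subst (HasCycle G) (sym c≡L+1) longest) ]
      (m≤n⇒m<n∨m≡n c≤L+1)
    where
    1<L : 1 < L
    1<L = ≤-trans (s≤s (s≤s z≤n)) 3≤L
    first≢last : first P ≢ last P
    first≢last = inner≢last P (<-trans (s≤s z≤n) 1<L)
    B₂ = nonadjacent⇒twoConnected block first∈B last∈B first≢last first≁last
    on-B = block-contains-path B? B₂ block P first∈B last∈B
    fan : IsFan P
    fan i 1≤i i<L = dominated _ (on-B i (<⇒≤ i<L)) (inner≢last P i<L)
                      (λ e → <⇒≢ 1≤i (sym (injective P i 0 (<⇒≤ i<L) z≤n e)))

    -- B − vertex P 1 is connected, so first P has a neighbour in B other than vertex P 1.
    detour : Reach G (B ─ vertex P 1) (first P) (last P)
    detour = proj₂ (proj₂ B₂) (vertex P 1) (on-B 1 (<⇒≤ 1<L)) _ _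
               (first∈B , λ e → 0≢1+n (injective P 0 1 z≤n (<⇒≤ 1<L) e))
               (last∈B , λ e → inner≢last P 1<L (sym e))
    longest : HasCycle G (suc L)
    longest with reach-first-step detour first≢last
    ... | w , first~w , w∈B , w≢P1 = fan-cycle-suc P fan 3≤L first~w w~last w≢P1 w≢last
      where
      w≢last : w ≢ last P
      w≢last e = first≁last (subst (Adj G (first P)) e first~w)
      w~last : Adj G w (last P)
      w~last = dominated w w∈B w≢last λ e → Graph.adj-irrefl G (subst (Adj G (first P)) e first~w)

lemma3p8 : (k : ℕ) → 5 ≤ k → (𝒞 : CycleFamily) → Dense k 𝒞 →
    {n : ℕ} (G : Graph n) (h : Fin n) → Free 𝒞 G →
    (B : VSet n) → IsBlock G B → NearlyDominated G B h →
    (u : Fin n) → B u → (u≢h : u ≢ h) → ¬ Adj G u h →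
    Free 𝒞 (addEdge G u h u≢h)
lemma3p8 k 5≤k 𝒞 (_ , _ , _) G h free B block nd u u∈B u≢h u≁h zero _ (() , _)
lemma3p8 k 5≤k 𝒞 ((𝒞k , _) , no-shorter , _) G h free B block nd u u∈B u≢h u≁h (suc L) 𝒞ℓ cycle
  with added-edge-cycle⇒path {G = G} {u≢h = u≢h} (free (suc L) 𝒞ℓ) cycle
... | P , first≡u , last≡h = finite-¬¬-decidable B λ B? → free k 𝒞k (cycles B? k 3≤k k≤ℓ)
  where
  k≤ℓ : k ≤ suc L
  k≤ℓ = ≮⇒≥ λ ℓ<k → no-shorter (suc L) ℓ<k 𝒞ℓ
  3≤k : 3 ≤ k
  3≤k = ≤-trans (s≤s (s≤s (s≤s z≤n))) 5≤k
  3≤L : 3 ≤ L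
  3≤L = ≤-trans (n≤1+n 3) (s≤s⁻¹ (≤-trans 5≤k k≤ℓ))
  cycles : Decidable B → ∀ c → 3 ≤ c → c ≤ suc L → HasCycle G c
  cycles B? = block-path-cycles block B? P first≡u last≡h u∈B (proj₁ nd) u≁h
                (nearlyDominated⇒dominated {G = G} nd u∈B u≢h u≁h) 3≤L
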